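{- Let $U$ be the $\gamma$-unitization of the GPEA $P$, let $\sim$ be a $\gamma$-congruence on $P$, and let $a,b\in P$. Then: (i) $a^{ - }\sim^{*}b^{ - }$ iff $a\sim b$. (ii) $a\sim b^{ -- }$ iff $a^{\sim\sim}\sim b$ iff $a^{\sim}\sim^{*}b^{ - }$.
   Context: $P$ is a GPEA (partial $\oplus$, constant $0$; partial associativity; conjugation; two-sided cancellation; neutral $0$; positivity), ordered by $a\le b$ iff $a\oplus c=b$ for some $c$; for $a\le b$, $a/b$ is the unique $c$ with $a\oplus c=b$ and $b\backslash a$ the unique $d$ with $d\oplus a=b$. $\gamma$ is a unitizing GPEA-automorphism ($\gamma a\oplus b$ defined iff $b\oplus a$ defined). The $\gamma$-unitization $U=P\cup P^\eta$ ($\eta$ a bijection of $P$ onto a disjoint set $P^\eta$, $1:=\eta0$): sums in $P$ as in $P$; $a+\eta b$ defined iff $a\le b$, equal to $\eta(b\backslash a)$; $\eta a+b$ defined iff $\gamma b\le a$, equal to $\eta(\gamma b/a)$; no sums within $P^\eta$. $U$ is a pseudo effect algebra; $x^\sim,x^-$ denote the unique elements with $x+x^\sim=1=x^-+x$; for $a\in P$, $\eta a=a^\sim$, $\gamma a=a^{ -- }$, $\gamma^{ -1}a=a^{\sim\sim}$. A congruence $\sim$ on $P$ is a $\gamma$-congruence iff $a\sim b\Leftrightarrow\gamma a\sim\gamma b$. Its extension $\sim^*$ to $U$: for $a,b\in P$, $a\sim^*b$ iff $a\sim b$, and $\eta a\sim^*\eta b$ iff $a\sim b$; no element of $P$ is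 $\sim^*$-related to an element of $P^\eta$. (Congruence: equivalence relation compatible with existing sums, (C2), and satisfying (C3): if $a\oplus b$ exists then for any $a_1\sim a$ some $b_1\sim b$ has $a_1\oplus b_1$ existing, and for any $b_2\sim b$ some $a_2\sim a$ has $a_2\oplus b_2$ existing.) -}

module Defs where

open import Level using (Level; _⊔_; suc)
open import Data.Maybe using (Maybe; just; nothing; is-just)
open import Data.Bool using (T)
open import Data.Product using (Σ; _×_; _,_)
open import Data.Sum using (_⊎_; inj₁; inj₂)
open import Data.Empty.Polymorphic using (⊥)
open import Relation.Binary.PropositionalEquality using (_≡_)
open import Relation.Binary.Structures using (IsEquivalence)
open import Function.Bundles using (_⇔_)

Defined : ∀ {c} {A : Set c} → Maybe A → Set
Defined m = T (is-just m)

record GPEA (c : Level) : Set (suc c) where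
  field
    Carrier : Set c
    _⊕_     : Carrier → Carrier → Maybe Carrier
    𝟘       : Carrier
    assocˡ  : ∀ a b c d e → a ⊕ b ≡ just d → d ⊕ c ≡ just e →
              Σ Carrier λ f → (b ⊕ c ≡ just f) × (a ⊕ f ≡ just e)
    assocʳ  : ∀ a b c f e → b ⊕ c ≡ just f → a ⊕ f ≡ just e →
              Σ Carrier λ d → (a ⊕ b ≡ just d) × (d ⊕ c ≡ just e)
    conj    : ∀ a b s → a ⊕ b ≡ just s →
              Σ Carrier λ d → Σ Carrier λ e → (d ⊕ a ≡ just s) × (b ⊕ e ≡ just s)
    cancelˡ : ∀ a b c s → a ⊕ b ≡ just s → a ⊕ c ≡ just s → b ≡ c
    cancelʳ : ∀ a b c s → b ⊕ a ≡ just s → c ⊕ a ≡ just s → b ≡ c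
    neutralʳ : ∀ a → a ⊕ 𝟘 ≡ just a
    neutralˡ : ∀ a → 𝟘 ⊕ a ≡ just a
    positive : ∀ a b → a ⊕ b ≡ just 𝟘 → (a ≡ 𝟘) × (b ≡ 𝟘)

  _≤_ : Carrier → Carrier → Set c
  a ≤ b = Σ Carrier λ c → a ⊕ c ≡ just b

module _ {c : Level} (P : GPEA c) where
  open GPEA P

  record IsUnitizingAutomorphism (γ γ⁻¹ : Carrier → Carrier) : Set c where
    field
      inverseˡ : ∀ a → γ⁻¹ (γ a) ≡ a
      inverseʳ : ∀ a → γ (γ⁻¹ a) ≡ a
      hom⇒    : ∀ a b s → a ⊕ b ≡ just s → γ a ⊕ γ b ≡ just (γ s)
      hom⇐    : ∀ a b t → γ a ⊕ γ b ≡ just t → Defined (a ⊕ b)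
      unitizing : ∀ a b → Defined (γ a ⊕ b) ⇔ Defined (b ⊕ a)

  record IsCongruence {ℓ : Level} (_∼_ : Carrier → Carrier → Set ℓ) : Set (c ⊔ ℓ) where
    field
      isEquivalence : IsEquivalence _∼_
      C2 : ∀ a b a₁ b₁ s s₁ → a ∼ a₁ → b ∼ b₁ →
           a ⊕ b ≡ just s → a₁ ⊕ b₁ ≡ just s₁ → s ∼ s₁
      C3ˡ : ∀ a b a₁ → Defined (a ⊕ b) → a₁ ∼ a →
            Σ Carrier λ b₁ → (b₁ ∼ b) × Defined (a₁ ⊕ b₁)
      C3ʳ : ∀ a b b₂ → Defined (a ⊕ b) → b₂ ∼ b →
            Σ Carrier λ a₂ → (a₂ ∼ a) × Defined (a₂ ⊕ b₂)

  record IsγCongruence {ℓ : Level} (γ : Carrier → Carrier)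
                       (_∼_ : Carrier → Carrier → Set ℓ) : Set (c ⊔ ℓ) where
    field
      isCongruence : IsCongruence _∼_
      γ-compat     : ∀ a b → (a ∼ b) ⇔ (γ a ∼ γ b)

  U : Set c
  U = Carrier ⊎ Carrier

  ι : Carrier → U
  ι = inj₁

  η : Carrier → U
  η = inj₂

  𝟙 : U
  𝟙 = η 𝟘

  -- Graph of the partial sum of U:  SumU γ x y z  means  x + y is defined and equals z.
  --  * a + b  (a,b ∈ P) as in P;
  --  * a + ηb defined iff a ≤ b, equal to η(b\a), where b\a is the unique d with d ⊕ a = b;
  --  * ηa + b defined iff γb ≤ a, equal to η(γb/a), where γb/a is the unique c with γb ⊕ c = a;
  --  * no sums within P^η.
  SumU : (γ : Carrier → Carrier) → U → U → U → Set c
  SumU γ (inj₁ a) (inj₁ b) (inj₁ s) = a ⊕ b ≡ just s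
  SumU γ (inj₁ a) (inj₁ b) (inj₂ s) = ⊥
  SumU γ (inj₁ a) (inj₂ b) (inj₁ s) = ⊥
  SumU γ (inj₁ a) (inj₂ b) (inj₂ d) = d ⊕ a ≡ just b
  SumU γ (inj₂ a) (inj₁ b) (inj₁ s) = ⊥
  SumU γ (inj₂ a) (inj₁ b) (inj₂ e) = γ b ⊕ e ≡ just a
  SumU γ (inj₂ a) (inj₂ b) z        = ⊥

  _[_]* : ∀ {ℓ} → (Carrier → Carrier → Set ℓ) → U → U → Set ℓ
  (_∼_ [ inj₁ a ]*) (inj₁ b) = a ∼ b
  (_∼_ [ inj₂ a ]*) (inj₂ b) = a ∼ b
  (_∼_ [ inj₁ a ]*) (inj₂ b) = ⊥
  (_∼_ [ inj₂ a ]*) (inj₁ b) = ⊥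

  Ext : ∀ {ℓ} → (Carrier → Carrier → Set ℓ) → U → U → Set ℓ
  Ext _∼_ x y = (_∼_ [ x ]*) y

module Submission where

-- In the γ-unitization U = P ∪ ηP the complements of an element are read off
-- directly from the defining clauses of the sum of U, using only that 0 is
-- neutral:  for a ∈ P,
--
--   a + ηa = 1,   η(γa) + a = 1,   ηa + y = 1 iff y ∈ P with γy = a,
--
-- so a^∼ = ηa, a⁻ = η(γa), (ηa)^∼ = γ⁻¹a and (ηa)⁻ = a.  After
-- substituting them, both parts of the theorem reduce to the defining property
-- of a γ-congruence, a ∼ b ⇔ γa ∼ γb:
--   (i)  a⁻ ∼* b⁻  is  γa ∼ γb;
--   (ii) writing a = γy:  a ∼ b⁻⁻ is γy ∼ γb,  a^∼∼ ∼ b is y ∼ b,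
--        and a^∼ ∼* b⁻ is again γy ∼ γb.

open import Defs
open import Level using (Level)
open import Data.Product using (Σ; _×_; _,_)
open import Data.Sum using (inj₁; inj₂)
open import Data.Maybe using (just)
open import Data.Maybe.Properties using (just-injective)
open import Function.Bundles using (_⇔_)
open import Function.Properties.Equivalence using () renaming (sym to ⇔-sym)
open import Relation.Binary.PropositionalEquality using (_≡_; refl; sym; trans; cong)

module Complements {c : Level} (P : GPEA c) (γ : GPEA.Carrier P → GPEA.Carrier P) where
  open GPEA P

  ⊕𝟘-determines : ∀ {x y} → x ⊕ 𝟘 ≡ just y → x ≡ y
  ⊕𝟘-determines {x} h = just-injective (trans (sym (neutralʳ x)) h)

  𝟘⊕-determines : ∀ {x y} → 𝟘 ⊕ x ≡ just y → x ≡ y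
  𝟘⊕-determines {x} h = just-injective (trans (sym (neutralˡ x)) h)

  right-complement-ι : ∀ {a} x → SumU P γ (ι P a) x (𝟙 P) → x ≡ η P a
  right-complement-ι (inj₂ u) h = cong inj₂ (sym (𝟘⊕-determines h))

  left-complement-ι : ∀ {a} x → SumU P γ x (ι P a) (𝟙 P) → x ≡ η P (γ a)
  left-complement-ι (inj₂ u) h = cong inj₂ (sym (⊕𝟘-determines h))

  right-complement-η : ∀ {a} x → SumU P γ (η P a) x (𝟙 P) →
                       Σ Carrier λ y → (x ≡ ι P y) × (γ y ≡ a)
  right-complement-η (inj₁ y) h = y , refl , ⊕𝟘-determines h

  left-complement-η : ∀ {a} x → SumU P γ x (η P a) (𝟙 P) → x ≡ ι P a
  left-complement-η (inj₁ z) h = cong inj₁ (𝟘⊕-determines h)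

open Complements

lemma4p16 : ∀ {c ℓ} (P : GPEA c) (γ γ⁻¹ : GPEA.Carrier P → GPEA.Carrier P) →
            IsUnitizingAutomorphism P γ γ⁻¹ →
            (_∼_ : GPEA.Carrier P → GPEA.Carrier P → Set ℓ) → IsγCongruence P γ _∼_ →
            (a b : GPEA.Carrier P) →
            (∀ (a⁻ b⁻ : U P) → SumU P γ a⁻ (ι P a) (𝟙 P) → SumU P γ b⁻ (ι P b) (𝟙 P) →
               (Ext P _∼_ a⁻ b⁻ ⇔ (a ∼ b)))
            ×
            (∀ (a∼ a∼∼ b⁻ b⁻⁻ : U P) →
               SumU P γ (ι P a) a∼ (𝟙 P) → SumU P γ a∼ a∼∼ (𝟙 P) →
               SumU P γ b⁻ (ι P b) (𝟙 P) → SumU P γ b⁻⁻ b⁻ (𝟙 P) →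
               (Ext P _∼_ (ι P a) b⁻⁻ ⇔ Ext P _∼_ a∼∼ (ι P b))
               × (Ext P _∼_ a∼∼ (ι P b) ⇔ Ext P _∼_ a∼ b⁻))
lemma4p16 P γ _ _ _∼_ γ-congruence a b = part-i , part-ii
  where
  open IsγCongruence γ-congruence using (γ-compat)

  part-i : ∀ (a⁻ b⁻ : U P) → SumU P γ a⁻ (ι P a) (𝟙 P) → SumU P γ b⁻ (ι P b) (𝟙 P) →
           Ext P _∼_ a⁻ b⁻ ⇔ (a ∼ b)
  part-i a⁻ b⁻ ha hb with left-complement-ι P γ a⁻ ha | left-complement-ι P γ b⁻ hb
  ... | refl | refl = ⇔-sym (γ-compat a b)

  part-ii : ∀ (a∼ a∼∼ b⁻ b⁻⁻ : U P) →
            SumU P γ (ι P a) a∼ (𝟙 P) → SumU P γ a∼ a∼∼ (𝟙 P) →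
            SumU P γ b⁻ (ι P b) (𝟙 P) → SumU P γ b⁻⁻ b⁻ (𝟙 P) →
            (Ext P _∼_ (ι P a) b⁻⁻ ⇔ Ext P _∼_ a∼∼ (ι P b))
            × (Ext P _∼_ a∼∼ (ι P b) ⇔ Ext P _∼_ a∼ b⁻)
  part-ii a∼ a∼∼ b⁻ b⁻⁻ h₁ h₂ h₃ h₄ with right-complement-ι P γ a∼ h₁ | left-complement-ι P γ b⁻ h₃
  ... | refl | refl with right-complement-η P γ a∼∼ h₂ | left-complement-η P γ b⁻⁻ h₄
  ...   | y , refl , refl | refl = ⇔-sym (γ-compat y b) , γ-compat y b
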